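{- Let $G$ be an st-graph, let $C_P=\{M_1,\dots,M_h\}$ be a (transitive) congruence partition of $G$, let $w_N$ be the dimensional neck of $G(C_P)$, and let $\rho=\max(h,|M_1|,\dots,|M_h|)$. Then $w_N\le\rho$.
   Context: An st-graph is a directed acyclic graph with exactly one source and one sink. The width of a DAG is the maximum size of a set of pairwise incomparable vertices (neither reaches the other via a directed path). Let $G^*$ be the transitive closure of $G=(V,E)$. A transitive module is a nonempty $M\subseteq V$ whose vertices all have the same predecessors and the same successors in $V\setminus M$ in $G^*$. A congruence partition $C_P=\{M_1,\dots,M_h\}$ is a partition of $V$ into transitive modules. The quotient graph $G_0$ (with $h$ vertices) is obtained from $G$ by merging the vertices of each $M_i$ into one vertex. For $1\le i\le h$, the module-induced graph $G_i$ is the subgraph induced by $M_i$, augmented when necessary with a virtual source (edges to all of $M_i$) and/or virtual sink (edges from all of $M_i$) so that it is an st-graph. $G(C_P)=\{G_0,\dots,G_h\}$ and its dimensional neck $w_N$ is the maximum width of a graph in $G(C_P)$. -}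

module Defs where

open import Data.Nat using (ℕ; _≤_; _⊔_)
open import Data.Fin using (Fin)
open import Data.Fin.Properties using (_≟_)
open import Data.List using (List; length; filter; map; foldr; allFin)
open import Data.List.Relation.Unary.All using (All)
open import Data.List.Relation.Unary.AllPairs using (AllPairs)
open import Data.Product using (Σ; ∃; _×_)
open import Relation.Nullary using (¬_)
open import Data.Empty using (⊥)
open import Data.Unit using (⊤)
open import Relation.Binary.PropositionalEquality using (_≡_; _≢_)
open import Relation.Binary.Construct.Closure.Transitive using (TransClosure)

-- A directed graph on a vertex type V is given by its edge relation.
-- Reachability in the transitive closure G* (paths of length ≥ 1).
Reach : {V : Set} → (V → V → Set) → V → V → Set
Reach E = TransClosure E

Incomparable : {V : Set} → (V → V → Set) → V → V → Set
Incomparable E x y = ¬ Reach E x y × ¬ Reach E y x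

Antichain : {V : Set} → (V → Set) → (V → V → Set) → List V → Set
Antichain Present E xs =
  All Present xs × AllPairs (λ x y → x ≢ y × Incomparable E x y) xs

WidthAtMost : {V : Set} → (V → Set) → (V → V → Set) → ℕ → Set
WidthAtMost Present E k = ∀ xs → Antichain Present E xs → length xs ≤ k

Acyclic : {V : Set} → (V → V → Set) → Set
Acyclic E = ∀ v → ¬ Reach E v v

IsSource IsSink : {n : ℕ} → (Fin n → Fin n → Set) → Fin n → Set
IsSource E v = ∀ u → ¬ E u v
IsSink E v = ∀ u → ¬ E v u

IsSTGraph : {n : ℕ} → (Fin n → Fin n → Set) → Set
IsSTGraph E =
  Acyclic E
  × (Σ _ λ s → IsSource E s × (∀ v → IsSource E v → v ≡ s))
  × (Σ _ λ t → IsSink E t × (∀ v → IsSink E v → v ≡ t))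

InModule : {n h : ℕ} → (Fin n → Fin h) → Fin h → Fin n → Set
InModule part i v = part v ≡ i

IsTransitiveModule : {n : ℕ} → (Fin n → Fin n → Set) → (Fin n → Set) → Set
IsTransitiveModule E M =
  (∃ λ v → M v)
  × (∀ x y z → M x → M y → ¬ M z →
       ((Reach E z x → Reach E z y) × (Reach E x z → Reach E y z)))

IsCongruencePartition : {n h : ℕ} → (Fin n → Fin n → Set) → (Fin n → Fin h) → Set
IsCongruencePartition E part = ∀ i → IsTransitiveModule E (InModule part i)

QuotEdge : {n h : ℕ} → (Fin n → Fin n → Set) → (Fin n → Fin h) → Fin h → Fin h → Set
QuotEdge E part i j =
  i ≢ j × (Σ _ λ u → Σ _ λ v → E u v × part u ≡ i × part v ≡ j)

-- Module-induced graph G_i: vertices of M_i plus possible virtual source/sink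
data ExtV (n : ℕ) : Set where
  vsrc : ExtV n
  vsnk : ExtV n
  orig : Fin n → ExtV n

module _ {n h : ℕ} (E : Fin n → Fin n → Set) (part : Fin n → Fin h) (i : Fin h) where

  private
    M = InModule part i

  IsModSource IsModSink : Fin n → Set
  IsModSource v = M v × (∀ u → M u → ¬ E u v)
  IsModSink v = M v × (∀ u → M u → ¬ E v u)

  NeedSrc NeedSnk : Set
  NeedSrc = ¬ (Σ _ λ s → IsModSource s × (∀ v → IsModSource v → v ≡ s))
  NeedSnk = ¬ (Σ _ λ t → IsModSink t × (∀ v → IsModSink v → v ≡ t))

  ModPresent : ExtV n → Set
  ModPresent vsrc = NeedSrc
  ModPresent vsnk = NeedSnk
  ModPresent (orig v) = M v

  ModEdge : ExtV n → ExtV n → Set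
  ModEdge (orig u) (orig v) = M u × M v × E u v
  ModEdge vsrc (orig v) = NeedSrc × M v
  ModEdge (orig u) vsnk = NeedSnk × M u
  ModEdge _ _ = ⊥

modSize : {n h : ℕ} → (Fin n → Fin h) → Fin h → ℕ
modSize {n} part i = length (filter (λ v → part v ≟ i) (allFin n))

rho : {n h : ℕ} → (Fin n → Fin h) → ℕ
rho {n} {h} part = h ⊔ foldr _⊔_ 0 (map (modSize part) (allFin h))

-- dimensional neck w_N ≤ k : every graph in G(C_P) has width ≤ k
NeckAtMost : {n h : ℕ} → (Fin n → Fin n → Set) → (Fin n → Fin h) → ℕ → Set
NeckAtMost {n} {h} E part k =
  WidthAtMost (λ (_ : Fin h) → ⊤) (QuotEdge E part) k
  × (∀ i → WidthAtMost (ModPresent E part i) (ModEdge E part i) k)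

-- The quotient graph has h vertices, so its antichains have at most h elements.
-- In a module-induced graph G_i the virtual source reaches, and the virtual sink
-- is reached from, every other vertex (M_i is nonempty), so a virtual vertex
-- only occurs in antichains of size 1; larger antichains consist of vertices
-- of M_i and have at most |M_i| elements.
module Submission where

open import Defs
open import Data.Nat using (ℕ; _≤_; _⊔_; s≤s; z≤n)
open import Data.Nat.Properties using (≤-trans; ≤-reflexive; m≤m⊔n; m≤n⊔m)
open import Data.Fin using (Fin; zero; suc)
open import Data.Fin.Properties using (_≟_; injective⇒≤)
open import Data.List using (List; []; _∷_; length; lookup; map; filter; foldr; allFin)
open import Data.List.Properties using (length-map)
open import Data.List.Membership.Propositional using (_∈_)
open import Data.List.Membership.Propositional.Properties using (∈-lookup; ∈-allFin; ∈-filter⁺; ∈-map⁺)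
open import Data.List.Relation.Binary.Subset.Propositional using (_⊆_)
open import Data.List.Relation.Unary.All as All using (_∷_)
open import Data.List.Relation.Unary.AllPairs as AllPairs using (_∷_)
open import Data.List.Relation.Unary.Any using (here; there; index)
open import Data.List.Relation.Unary.Any.Properties using (lookup-index)
open import Data.List.Relation.Unary.Unique.Propositional using (Unique)
open import Data.Unit using (⊤)
open import Data.Product using (∃; _×_; _,_; proj₁; proj₂; swap)
open import Function.Definitions using (Injective)
open import Relation.Nullary using (contradiction)
open import Relation.Binary.PropositionalEquality using (_≡_; _≢_; refl; sym; cong; ≢-sym; module ≡-Reasoning)
open import Relation.Binary.Construct.Closure.Transitive using ([_]; _∷_)

module _ {A : Set} where

  Unique⇒lookup-injective : ∀ {xs : List A} → Unique xs → Injective _≡_ _≡_ (lookup xs)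
  Unique⇒lookup-injective (_ ∷ _)   {zero}  {zero}  _  = refl
  Unique⇒lookup-injective (x≢ ∷ _)  {zero}  {suc j} eq = contradiction eq (All.lookup x≢ (∈-lookup j))
  Unique⇒lookup-injective (x≢ ∷ _)  {suc i} {zero}  eq = contradiction (sym eq) (All.lookup x≢ (∈-lookup i))
  Unique⇒lookup-injective (_ ∷ xs!) {suc i} {suc j} eq = cong suc (Unique⇒lookup-injective xs! eq)

  Unique-⊆⇒length≤ : ∀ {xs ys : List A} → Unique xs → xs ⊆ ys → length xs ≤ length ys
  Unique-⊆⇒length≤ {xs} {ys} xs! xs⊆ys = injective⇒≤ position-injective
    where
    position : Fin (length xs) → Fin (length ys)
    position k = index (xs⊆ys (∈-lookup k))

    position-injective : Injective _≡_ _≡_ position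
    position-injective {k} {l} eq = Unique⇒lookup-injective xs! (begin
      lookup xs k            ≡⟨ lookup-index (xs⊆ys (∈-lookup k)) ⟩
      lookup ys (position k) ≡⟨ cong (lookup ys) eq ⟩
      lookup ys (position l) ≡⟨ lookup-index (xs⊆ys (∈-lookup l)) ⟨
      lookup xs l            ∎)
      where open ≡-Reasoning

Unique⇒length≤ : ∀ {h} {xs : List (Fin h)} → Unique xs → length xs ≤ h
Unique⇒length≤ xs! = injective⇒≤ (Unique⇒lookup-injective xs!)

∈⇒≤-foldr-⊔ : ∀ {x} {ns : List ℕ} → x ∈ ns → x ≤ foldr _⊔_ 0 ns
∈⇒≤-foldr-⊔ {ns = n ∷ _}  (here refl) = m≤m⊔n n _
∈⇒≤-foldr-⊔ {ns = n ∷ ns} (there x∈)  = ≤-trans (∈⇒≤-foldr-⊔ x∈) (m≤n⊔m n _)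

module _ {n h : ℕ} (part : Fin n → Fin h) where

  h≤rho : h ≤ rho part
  h≤rho = m≤m⊔n h _

  modSize≤rho : ∀ i → modSize part i ≤ rho part
  modSize≤rho i = ≤-trans (∈⇒≤-foldr-⊔ (∈-map⁺ (modSize part) (∈-allFin i))) (m≤n⊔m h _)

  quotientWidth≤rho : (E : Fin n → Fin n → Set) → WidthAtMost (λ _ → ⊤) (QuotEdge E part) (rho part)
  quotientWidth≤rho _ _ (_ , pairs) = ≤-trans (Unique⇒length≤ (AllPairs.map proj₁ pairs)) h≤rho

  1≤rho : Fin h → 1 ≤ rho part
  1≤rho zero    = ≤-trans (s≤s z≤n) h≤rho
  1≤rho (suc _) = ≤-trans (s≤s z≤n) h≤rho

module _ {n h : ℕ} (E : Fin n → Fin n → Set) (part : Fin n → Fin h) (i : Fin h)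
         (M-nonempty : ∃ (InModule part i)) where

  private
    Present = ModPresent E part i
    Edge    = ModEdge E part i
    u       = proj₁ M-nonempty
    u∈M     = proj₂ M-nonempty

  moduleVertices : List (ExtV n)
  moduleVertices = map orig (filter (λ v → part v ≟ i) (allFin n))

  length-moduleVertices : length moduleVertices ≡ modSize part i
  length-moduleVertices = length-map orig (filter (λ v → part v ≟ i) (allFin n))

  vsrc-reaches : ∀ b → Present vsrc → Present b → b ≢ vsrc → Reach Edge vsrc b
  vsrc-reaches vsrc     _   _   b≢vsrc = contradiction refl b≢vsrc
  vsrc-reaches vsnk     src snk _      = _∷_ {y = orig u} (src , u∈M) [ snk , u∈M ]
  vsrc-reaches (orig _) src w∈M _      = [ src , w∈M ]

  reaches-vsnk : ∀ a → Present vsnk → Present a → a ≢ vsnk → Reach Edge a vsnk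
  reaches-vsnk vsnk     _   _   a≢vsnk = contradiction refl a≢vsnk
  reaches-vsnk vsrc     snk src _      = _∷_ {y = orig u} (src , u∈M) [ snk , u∈M ]
  reaches-vsnk (orig _) snk w∈M _      = [ snk , w∈M ]

  incomparable⇒∈moduleVertices : ∀ {a b} → Present a → Present b →
    a ≢ b × Incomparable Edge a b → a ∈ moduleVertices
  incomparable⇒∈moduleVertices {vsrc} src pb (a≢b , ¬a→b , _) =
    contradiction (vsrc-reaches _ src pb (≢-sym a≢b)) ¬a→b
  incomparable⇒∈moduleVertices {vsnk} snk pb (a≢b , _ , ¬b→a) =
    contradiction (reaches-vsnk _ snk pb (≢-sym a≢b)) ¬b→a
  incomparable⇒∈moduleVertices {orig v} v∈M _ _ = ∈-map⁺ orig (∈-filter⁺ _ (∈-allFin v) v∈M)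

  antichain⊆moduleVertices : ∀ {x y zs} → Antichain Present Edge (x ∷ y ∷ zs) →
    x ∷ y ∷ zs ⊆ moduleVertices
  antichain⊆moduleVertices (px ∷ pys , (rxy ∷ rxs) ∷ _) = All.lookup
    (incomparable⇒∈moduleVertices px (All.head pys) rxy
      ∷ All.zipWith (λ (pz , rxz) → incomparable⇒∈moduleVertices pz px (symmetric rxz)) (pys , rxy ∷ rxs))
    where
    symmetric : ∀ {a b} → a ≢ b × Incomparable Edge a b → b ≢ a × Incomparable Edge b a
    symmetric (a≢b , inc) = (≢-sym a≢b) , swap inc

  moduleWidth≤rho : WidthAtMost Present Edge (rho part)
  moduleWidth≤rho []           _  = z≤n
  moduleWidth≤rho (_ ∷ [])     _  = 1≤rho part i
  moduleWidth≤rho (_ ∷ _ ∷ _) ac@(_ , pairs) =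
    ≤-trans (Unique-⊆⇒length≤ (AllPairs.map proj₁ pairs) (antichain⊆moduleVertices ac))
      (≤-trans (≤-reflexive length-moduleVertices) (modSize≤rho part i))

lemma14 : (n h : ℕ) (E : Fin n → Fin n → Set) (part : Fin n → Fin h) →
    IsSTGraph E → IsCongruencePartition E part →
    NeckAtMost E part (rho part)
lemma14 n h E part _ congruence =
    quotientWidth≤rho part E
  , λ i → moduleWidth≤rho E part i (proj₁ (congruence i))
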